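{- Let $n,k$ be positive integers with $\gcd(6k,n)=1$, let $q=2^n$, and let $\phi_k:\mathbb{F}_q^2\to\mathbb{F}_q^2$ be $\phi_k(x,y)=(x^{2^k}+y,\; y^{2^k}+x+y)$. Then the three affine planes $\mathrm{AG}(2,q)$, $\mathrm{AG}(2,q)^{\phi_k}$ and $\mathrm{AG}(2,q)^{\phi_k\circ\phi_k}$ are mutually orthogoval.
   Context: $\mathrm{AG}(2,q)$ denotes the standard Desarguesian affine plane with point set $\mathbb{F}_q^2$ whose lines are the sets $\{(x,y): ax+by=c\}$ with $(a,b)\neq(0,0)$. For a bijection $f$ of $\mathbb{F}_q^2$, $\mathrm{AG}(2,q)^f$ denotes the affine plane on $\mathbb{F}_q^2$ whose lines are the images $f(L)$ of the lines $L$ of $\mathrm{AG}(2,q)$. Two affine planes of the same order on the same point set are orthogoval if every line of one meets every line of the other in at most two points; a set of planes is mutually orthogoval if pairwise orthogoval. -}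

module Defs where

open import Level using (0ℓ)
open import Data.Nat using (ℕ; zero; suc)
open import Data.Fin using (Fin)
open import Data.Product using (_×_; _,_; ∃; proj₁; proj₂)
open import Data.Sum using (_⊎_)
open import Relation.Nullary using (¬_)
open import Relation.Binary.PropositionalEquality using (_≡_)
open import Algebra.Structures using (IsCommutativeRing)
open import Function.Bundles using (_↔_)
open import Function using (_∘_)

record FiniteField (q : ℕ) : Set₁ where
  infixl 6 _+_
  infixl 7 _*_
  field
    Carrier : Set
    _+_ _*_ : Carrier → Carrier → Carrier
    -_      : Carrier → Carrier
    0# 1#   : Carrier
    isCommutativeRing : IsCommutativeRing _≡_ _+_ _*_ -_ 0# 1#
    0≢1     : ¬ (0# ≡ 1#)
    inverse : ∀ x → ¬ (x ≡ 0#) → ∃ λ y → x * y ≡ 1#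
    enumeration : Fin q ↔ Carrier

module AffinePlanes {q : ℕ} (F : FiniteField q) where
  open FiniteField F

  pow : Carrier → ℕ → Carrier
  pow x zero    = 1#
  pow x (suc m) = x * pow x m

  Point : Set
  Point = Carrier × Carrier

  record Line : Set where
    constructor line
    field
      a b c   : Carrier
      nondeg  : ¬ (a ≡ 0# × b ≡ 0#)

  _∈AG_ : Point → Line → Set
  (x , y) ∈AG line a b c _ = a * x + b * y ≡ c

  -- incidence in AG(2,q)^f : the lines are the images f(L)
  _∈AG[_]_ : Point → (Point → Point) → Line → Set
  P ∈AG[ f ] L = ∃ λ p → p ∈AG L × f p ≡ P

  Orthogoval : (Point → Line → Set) → (Point → Line → Set) → Set
  Orthogoval I J =
    ∀ (L M : Line) (P₁ P₂ P₃ : Point) →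
      I P₁ L → I P₂ L → I P₃ L → J P₁ M → J P₂ M → J P₃ M →
      (P₁ ≡ P₂) ⊎ (P₁ ≡ P₃) ⊎ (P₂ ≡ P₃)

  AG : Point → Line → Set
  AG = _∈AG_

  AG^ : (Point → Point) → Point → Line → Set
  AG^ f P L = P ∈AG[ f ] L

  φ : ℕ → Point → Point
  φ k (x , y) = (pow x (2 Data.Nat.^ k) + y , pow y (2 Data.Nat.^ k) + x + y)

module Submission where

-- Over GF(2^n) the map σⱼ = x ↦ x^(2^j) is an additive, multiplicative
-- bijection; its periods are closed under differences and contain n, so by
-- Bézout its only fixed points are 0 and 1 when gcd(j, n) = 1.
--
-- If P₁, P₂, P₃ lie on a line L and are images f(p₁), f(p₂), f(p₃) of points
-- on a line M, for an additive f, then p₃ − p₁ = λ (p₂ − p₁) for some λ and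
-- the vectors f(w), f(λ w) with w = p₂ − p₁ are parallel, det(f w, f(λ w)) = 0.
-- For f = φₖ and f = φₖ ∘ φₖ this determinant factors as (λ + σⱼ λ) Q(w),
-- j = k resp. 2k, where Q(w) = 0 with w ≠ 0 produces a root of r σⱼ(r) = 1 + r.
-- Applying σⱼ to such a root three times gives σ₃ⱼ(r) = r, so r ∈ {0, 1},
-- neither of which is a root. Hence w = 0 or λ ∈ {0, 1}: two of the points
-- coincide. The form Q for φₖ is also a combination of the coordinates of
-- φₖ(w), so φₖ is injective, hence bijective, and the third orthogovality is
-- the image of the first under φₖ.

open import Defs
open import Level using (0ℓ)
open import Data.Nat as ℕ using (ℕ; zero; suc; _<_; _^_)
open import Data.Nat.Properties as ℕ using ()
open import Data.Nat.Tactic.RingSolver using (solve-∀)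
open import Data.Nat.GCD using (gcd; module Bézout)
open import Data.Nat.Coprimality using (Coprime; coprime-Bézout; gcd≡1⇒coprime)
open import Data.Nat.Divisibility using (divides; ∣-trans)
open import Data.Fin as Fin using (Fin; punchIn; punchOut)
open import Data.Fin.Properties using (*↔×; punchInᵢ≢i; punchOut-injective; injective⇒≤; any?)
open import Data.Fin.Permutation using (Permutation; permutation)
open import Data.Product as Product using (_×_; _,_; ∃; proj₁; proj₂)
open import Data.Product.Function.NonDependent.Propositional using (_×-↔_)
open import Data.Sum as Sum using (_⊎_; inj₁; inj₂; [_,_]′)
open import Data.Empty using (⊥-elim)
open import Relation.Nullary using (yes; no)
open import Relation.Nullary.Decidable using (via-injection)
open import Relation.Binary.Definitions using (DecidableEquality)
open import Relation.Binary.PropositionalEquality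
open import Function using (_∘_; id; Inverse; Injection)
open import Function.Bundles using (_↔_)
open import Function.Definitions using (Injective; Surjective; Bijective)
open import Function.Properties.Inverse using (↔-sym; ↔-trans; ↔⇒↣)
open import Algebra.Bundles using (CommutativeRing)

Fin-injective⇒onto : ∀ {m} (f : Fin m → Fin m) → Injective _≡_ _≡_ f → ∀ j → ∃ λ i → f i ≡ j
Fin-injective⇒onto {zero} f inj ()
Fin-injective⇒onto {suc m} f inj j with any? (λ i → f i Fin.≟ j)
... | yes hit = hit
... | no miss = ⊥-elim (ℕ.<-irrefl refl (injective⇒≤ g-injective))
  where
  g : Fin (suc m) → Fin m
  g i = punchOut (λ j≡fi → miss (i , sym j≡fi))
  g-injective : Injective _≡_ _≡_ g
  g-injective {x} {y} eq = inj (punchOut-injective {i = j} (λ e → miss (x , sym e)) (λ e → miss (y , sym e)) eq)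

Fin-injective⇒permutation : ∀ {m} (f : Fin m → Fin m) → Injective _≡_ _≡_ f → Permutation m m
Fin-injective⇒permutation f inj =
  permutation f (proj₁ ∘ onto) (proj₂ ∘ onto) (λ i → inj (proj₂ (onto (f i))))
  where onto = Fin-injective⇒onto f inj

injective⇒surjective : ∀ {m} {A : Set} → Fin m ↔ A → (f : A → A) →
                       Injective _≡_ _≡_ f → Surjective _≡_ _≡_ f
injective⇒surjective e f inj y = to i , λ z≡x → trans (cong f z≡x) f[to-i]≡y
  where
  open Inverse e using (to; from)
  from-injective : Injective _≡_ _≡_ from
  from-injective = Injection.injective (↔⇒↣ (↔-sym e))
  g = from ∘ f ∘ to
  g-injective : Injective _≡_ _≡_ g
  g-injective eq = Injection.injective (↔⇒↣ e) (inj (from-injective eq))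
  i = proj₁ (Fin-injective⇒onto g g-injective (from y))
  f[to-i]≡y : f (to i) ≡ y
  f[to-i]≡y = from-injective (proj₂ (Fin-injective⇒onto g g-injective (from y)))

module FieldProperties {q : ℕ} (F : FiniteField q) where
  open FiniteField F public
  open AffinePlanes F public using (pow)

  commutativeRing : CommutativeRing 0ℓ 0ℓ
  commutativeRing = record { isCommutativeRing = isCommutativeRing }

  open CommutativeRing commutativeRing public
    using ( +-identityˡ; +-identityʳ; +-assoc; -‿inverseˡ
          ; +-comm; *-identityˡ; *-identityʳ; *-assoc; *-comm; zeroˡ; zeroʳ
          ; ring; +-group)
  open import Algebra.Solver.Ring.NaturalCoefficients.Default
    (CommutativeRing.commutativeSemiring commutativeRing) public
  open import Algebra.Properties.CommutativeMonoid.Sum (CommutativeRing.*-commutativeMonoid commutativeRing)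
    using (sum-remove; sum-permute; sum-cong-≗) renaming (sum to ∏)

  _≟_ : DecidableEquality Carrier
  _≟_ = via-injection (↔⇒↣ (↔-sym enumeration)) Fin._≟_

  x*x⁻¹≡1⇒x⁻¹*[x*y]≡y : ∀ {x x⁻¹} → x * x⁻¹ ≡ 1# → ∀ y → x⁻¹ * (x * y) ≡ y
  x*x⁻¹≡1⇒x⁻¹*[x*y]≡y {x} {x⁻¹} x*x⁻¹≡1 y = begin
    x⁻¹ * (x * y) ≡⟨ solve 3 (λ x x⁻¹ y → x⁻¹ :* (x :* y) := (x :* x⁻¹) :* y) refl x x⁻¹ y ⟩
    (x * x⁻¹) * y ≡⟨ cong (_* y) x*x⁻¹≡1 ⟩
    1# * y        ≡⟨ *-identityˡ y ⟩
    y             ∎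
    where open ≡-Reasoning

  *-cancelˡ : ∀ x {y z} → x ≢ 0# → x * y ≡ x * z → y ≡ z
  *-cancelˡ x {y} {z} x≢0 xy≡xz = begin
    y             ≡⟨ sym (cancel y) ⟩
    x⁻¹ * (x * y) ≡⟨ cong (x⁻¹ *_) xy≡xz ⟩
    x⁻¹ * (x * z) ≡⟨ cancel z ⟩
    z             ∎
    where
    open ≡-Reasoning
    x⁻¹ = proj₁ (inverse x x≢0)
    cancel = x*x⁻¹≡1⇒x⁻¹*[x*y]≡y (proj₂ (inverse x x≢0))

  x*y≡0⇒x≡0⊎y≡0 : ∀ x y → x * y ≡ 0# → x ≡ 0# ⊎ y ≡ 0#
  x*y≡0⇒x≡0⊎y≡0 x y xy≡0 with x ≟ 0#
  ... | yes x≡0 = inj₁ x≡0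
  ... | no  x≢0 = inj₂ (*-cancelˡ x x≢0 (trans xy≡0 (sym (zeroʳ x))))

  *-nonzero : ∀ {x y} → x ≢ 0# → y ≢ 0# → x * y ≢ 0#
  *-nonzero x≢0 y≢0 xy≡0 = [ x≢0 , y≢0 ]′ (x*y≡0⇒x≡0⊎y≡0 _ _ xy≡0)

  x*x≡x⇒x≡0⊎x≡1 : ∀ {x} → x * x ≡ x → x ≡ 0# ⊎ x ≡ 1#
  x*x≡x⇒x≡0⊎x≡1 {x} x*x≡x with x ≟ 0#
  ... | yes x≡0 = inj₁ x≡0
  ... | no  x≢0 = inj₂ (*-cancelˡ x x≢0 (trans x*x≡x (sym (*-identityʳ x))))

  pow-+ : ∀ x a b → pow x (a ℕ.+ b) ≡ pow x a * pow x b
  pow-+ x zero    b = sym (*-identityˡ _)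
  pow-+ x (suc a) b = trans (cong (x *_) (pow-+ x a b)) (sym (*-assoc _ _ _))

  pow-distrib-* : ∀ x y m → pow (x * y) m ≡ pow x m * pow y m
  pow-distrib-* x y zero    = sym (*-identityˡ 1#)
  pow-distrib-* x y (suc m) = begin
    x * y * pow (x * y) m         ≡⟨ cong (x * y *_) (pow-distrib-* x y m) ⟩
    x * y * (pow x m * pow y m)   ≡⟨ solve 4 (λ x y a b → x :* y :* (a :* b) := x :* a :* (y :* b)) refl x y (pow x m) (pow y m) ⟩
    x * pow x m * (y * pow y m)   ∎
    where open ≡-Reasoning

  pow-double : ∀ x m → pow x (2 ℕ.* m) ≡ pow (x * x) m
  pow-double x m = begin
    pow x (m ℕ.+ (m ℕ.+ 0))   ≡⟨ pow-+ x m (m ℕ.+ 0) ⟩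
    pow x m * pow x (m ℕ.+ 0) ≡⟨ cong (λ e → pow x m * pow x e) (ℕ.+-identityʳ m) ⟩
    pow x m * pow x m         ≡⟨ sym (pow-distrib-* x x m) ⟩
    pow (x * x) m             ∎
    where open ≡-Reasoning

  pow-1 : ∀ m → pow 1# m ≡ 1#
  pow-1 zero    = refl
  pow-1 (suc m) = trans (*-identityˡ _) (pow-1 m)

  ∏-scale : ∀ x {m} (f : Fin m → Carrier) → ∏ (λ i → x * f i) ≡ pow x m * ∏ f
  ∏-scale x {zero}  f = sym (*-identityʳ 1#)
  ∏-scale x {suc m} f = begin
    x * f₀ * ∏ (λ i → x * f (Fin.suc i)) ≡⟨ cong (x * f₀ *_) (∏-scale x (f ∘ Fin.suc)) ⟩
    x * f₀ * (pow x m * ∏ (f ∘ Fin.suc))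
      ≡⟨ solve 4 (λ x a p r → x :* a :* (p :* r) := x :* p :* (a :* r)) refl x f₀ (pow x m) (∏ (f ∘ Fin.suc)) ⟩
    x * pow x m * (f₀ * ∏ (f ∘ Fin.suc))   ∎
    where
    open ≡-Reasoning
    f₀ = f Fin.zero

  ∏-nonzero : ∀ {m} (f : Fin m → Carrier) → (∀ i → f i ≢ 0#) → ∏ f ≢ 0#
  ∏-nonzero {zero}  f f≢0 1≡0 = 0≢1 (sym 1≡0)
  ∏-nonzero {suc m} f f≢0     = *-nonzero (f≢0 Fin.zero) (∏-nonzero (f ∘ Fin.suc) (f≢0 ∘ Fin.suc))

  orOne : Carrier → Carrier
  orOne y with y ≟ 0#
  ... | yes _ = 1#
  ... | no  _ = y

  orOne-0 : ∀ {y} → y ≡ 0# → orOne y ≡ 1#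
  orOne-0 {y} y≡0 with y ≟ 0#
  ... | yes _   = refl
  ... | no  y≢0 = ⊥-elim (y≢0 y≡0)

  orOne-≢0 : ∀ {y} → y ≢ 0# → orOne y ≡ y
  orOne-≢0 {y} y≢0 with y ≟ 0#
  ... | yes y≡0 = ⊥-elim (y≢0 y≡0)
  ... | no  _   = refl

  -- Multiplication by x permutes the carrier; orOne turns the product over
  -- the whole carrier into the product P of all units, so P ≡ x ^ (q - 1) * P.
  x^[q-1]≡1 : ∀ {m} → Fin (suc m) ↔ Carrier → ∀ x → x ≢ 0# → pow x m ≡ 1#
  x^[q-1]≡1 {m} e x x≢0 = *-cancelˡ P (∏-nonzero unit unit≢0) (begin
    P * pow x m                  ≡⟨ *-comm P (pow x m) ⟩
    pow x m * P                  ≡⟨ sym (∏-scale x unit) ⟩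
    ∏ (λ j → x * unit j)         ≡⟨ sym (∏-orOne (x *_) (zeroʳ x) (*-nonzero x≢0)) ⟩
    ∏ (λ i → orOne (x * to i))   ≡⟨ sum-cong-≗ {suc m} (λ i → cong orOne (sym (strictlyInverseˡ (x * to i)))) ⟩
    ∏ (orOne ∘ to ∘ multiply)    ≡⟨ sym (sum-permute (orOne ∘ to) (Fin-injective⇒permutation multiply multiply-injective)) ⟩
    ∏ (orOne ∘ to)               ≡⟨ ∏-orOne (λ y → y) refl (λ y≢0 → y≢0) ⟩
    P                            ≡⟨ sym (*-identityʳ P) ⟩
    P * 1#                       ∎)
    where
    open Inverse e using (to; from; strictlyInverseˡ; strictlyInverseʳ)
    open ≡-Reasoning
    to-injective : Injective _≡_ _≡_ to
    to-injective = Injection.injective (↔⇒↣ e)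
    from-injective : Injective _≡_ _≡_ from
    from-injective = Injection.injective (↔⇒↣ (↔-sym e))

    index₀ : Fin (suc m)
    index₀ = from 0#
    unit : Fin m → Carrier
    unit j = to (punchIn index₀ j)
    unit≢0 : ∀ j → unit j ≢ 0#
    unit≢0 j unit≡0 = punchInᵢ≢i index₀ j (trans (sym (strictlyInverseʳ _)) (cong from unit≡0))
    P : Carrier
    P = ∏ unit

    ∏-orOne : (g : Carrier → Carrier) → g 0# ≡ 0# → (∀ {y} → y ≢ 0# → g y ≢ 0#) →
              ∏ (orOne ∘ g ∘ to) ≡ ∏ (g ∘ unit)
    ∏-orOne g g0≡0 g≢0 = begin
      ∏ (orOne ∘ g ∘ to)                            ≡⟨ sum-remove {i = index₀} (orOne ∘ g ∘ to) ⟩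
      orOne (g (to index₀)) * ∏ (orOne ∘ g ∘ unit)  ≡⟨ cong₂ _*_ (orOne-0 (trans (cong g (strictlyInverseˡ 0#)) g0≡0))
                                                                (sum-cong-≗ (λ j → orOne-≢0 (g≢0 (unit≢0 j)))) ⟩
      1# * ∏ (g ∘ unit)                             ≡⟨ *-identityˡ _ ⟩
      ∏ (g ∘ unit)                                  ∎

    multiply : Fin (suc m) → Fin (suc m)
    multiply i = from (x * to i)
    multiply-injective : Injective _≡_ _≡_ multiply
    multiply-injective eq = to-injective (*-cancelˡ x x≢0 (from-injective eq))

  x^q≡x : ∀ x → pow x q ≡ x
  x^q≡x = x^card≡x enumeration
    where
    x^card≡x : ∀ {m} → Fin m ↔ Carrier → ∀ x → pow x m ≡ x
    x^card≡x {zero}  e x with () ← Inverse.from e 0#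
    x^card≡x {suc m} e x with x ≟ 0#
    ... | yes x≡0 = trans (cong (λ y → y * pow y m) x≡0) (trans (zeroˡ _) (sym x≡0))
    ... | no  x≢0 = trans (cong (x *_) (x^[q-1]≡1 e x x≢0)) (*-identityʳ x)

Characteristic2 : ∀ {q} → FiniteField q → Set
Characteristic2 F = 1# + 1# ≡ 0#
  where open FiniteField F

module Characteristic2Properties {q : ℕ} (F : FiniteField q)
    (1+1≡0 : Characteristic2 F) where
  open FieldProperties F public

  x+x≡0 : ∀ x → x + x ≡ 0#
  x+x≡0 x = begin
    x + x         ≡⟨ solve 1 (λ x → x :+ x := x :* (con 1 :+ con 1)) refl x ⟩
    x * (1# + 1#) ≡⟨ cong (x *_) 1+1≡0 ⟩
    x * 0#        ≡⟨ zeroʳ x ⟩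
    0#            ∎
    where open ≡-Reasoning

  x+[y+y]≡x : ∀ x y → x + (y + y) ≡ x
  x+[y+y]≡x x y = trans (cong (x +_) (x+x≡0 y)) (+-identityʳ x)

  x≡y+[t+t]⇒x≡y : ∀ {x y} t → x ≡ y + (t + t) → x ≡ y
  x≡y+[t+t]⇒x≡y {y = y} t eq = trans eq (x+[y+y]≡x y t)

  x+y≡0⇒x≡y : ∀ {x y} → x + y ≡ 0# → x ≡ y
  x+y≡0⇒x≡y {x} {y} x+y≡0 = begin
    x             ≡⟨ sym (x+[y+y]≡x x y) ⟩
    x + (y + y)   ≡⟨ sym (+-assoc x y y) ⟩
    x + y + y     ≡⟨ cong (_+ y) x+y≡0 ⟩
    0# + y        ≡⟨ +-identityˡ y ⟩
    y             ∎
    where open ≡-Reasoning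

  +-cancelʳ : ∀ {x y} z → x + z ≡ y + z → x ≡ y
  +-cancelʳ {x} {y} z x+z≡y+z = x+y≡0⇒x≡y (begin
    x + y                 ≡⟨ sym (x+[y+y]≡x (x + y) z) ⟩
    x + y + (z + z)       ≡⟨ solve 3 (λ x y z → x :+ y :+ (z :+ z) := (x :+ z) :+ (y :+ z)) refl x y z ⟩
    (x + z) + (y + z)     ≡⟨ cong (_+ (y + z)) x+z≡y+z ⟩
    (y + z) + (y + z)     ≡⟨ x+x≡0 (y + z) ⟩
    0#                    ∎)
    where open ≡-Reasoning

  square-+ : ∀ x y → (x + y) * (x + y) ≡ x * x + y * y
  square-+ x y = trans
    (solve 2 (λ x y → (x :+ y) :* (x :+ y) := x :* x :+ y :* y :+ (x :* y :+ x :* y)) refl x y)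
    (x+[y+y]≡x _ (x * y))

  square-injective : ∀ {x y} → x * x ≡ y * y → x ≡ y
  square-injective {x} {y} x²≡y² = [ x+y≡0⇒x≡y , x+y≡0⇒x≡y ]′ (x*y≡0⇒x≡0⊎y≡0 (x + y) (x + y) (begin
    (x + y) * (x + y) ≡⟨ square-+ x y ⟩
    x * x + y * y     ≡⟨ cong (_+ y * y) x²≡y² ⟩
    y * y + y * y     ≡⟨ x+x≡0 (y * y) ⟩
    0#                ∎))
    where open ≡-Reasoning

  frob : ℕ → Carrier → Carrier
  frob zero    x = x
  frob (suc j) x = frob j (x * x)

  pow-2^≡frob : ∀ j x → pow x (2 ^ j) ≡ frob j x
  pow-2^≡frob zero    x = *-identityʳ x
  pow-2^≡frob (suc j) x = trans (pow-double x (2 ^ j)) (pow-2^≡frob j (x * x))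

  frob-∘ : ∀ i j x → frob i (frob j x) ≡ frob (j ℕ.+ i) x
  frob-∘ i zero    x = refl
  frob-∘ i (suc j) x = frob-∘ i j (x * x)

  frob-+ : ∀ j x y → frob j (x + y) ≡ frob j x + frob j y
  frob-+ zero    x y = refl
  frob-+ (suc j) x y = trans (cong (frob j) (square-+ x y)) (frob-+ j (x * x) (y * y))

  frob-* : ∀ j x y → frob j (x * y) ≡ frob j x * frob j y
  frob-* zero    x y = refl
  frob-* (suc j) x y = trans
    (cong (frob j) (solve 2 (λ x y → (x :* y) :* (x :* y) := (x :* x) :* (y :* y)) refl x y))
    (frob-* j (x * x) (y * y))

  frob-0 : ∀ j → frob j 0# ≡ 0#
  frob-0 zero    = refl
  frob-0 (suc j) = trans (cong (frob j) (zeroʳ 0#)) (frob-0 j)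

  frob-1 : ∀ j → frob j 1# ≡ 1#
  frob-1 zero    = refl
  frob-1 (suc j) = trans (cong (frob j) (*-identityʳ 1#)) (frob-1 j)

  frob-injective : ∀ j → Injective _≡_ _≡_ (frob j)
  frob-injective zero    eq = eq
  frob-injective (suc j) eq = square-injective (frob-injective j eq)

  frob≡0⇒≡0 : ∀ j {x} → frob j x ≡ 0# → x ≡ 0#
  frob≡0⇒≡0 j fx≡0 = frob-injective j (trans fx≡0 (sym (frob-0 j)))

module _ {q : ℕ} (F : FiniteField q) where
  open FiniteField F using (enumeration)
  open AffinePlanes F

  Point-enumeration : Fin (q ℕ.* q) ↔ Point
  Point-enumeration = ↔-trans *↔× (enumeration ×-↔ enumeration)

  orthogoval-image : {I J I′ J′ : Point → Line → Set} (f : Point → Point) → Injective _≡_ _≡_ f →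
                     (∀ {P L} → I′ P L → ∃ λ p → I p L × f p ≡ P) →
                     (∀ {P L} → J′ P L → ∃ λ p → J p L × f p ≡ P) →
                     Orthogoval I J → Orthogoval I′ J′
  orthogoval-image {J = J} f f-injective I′⊆fI J′⊆fJ I⊥J L M P₁ P₂ P₃ i₁ i₂ i₃ j₁ j₂ j₃
    with I′⊆fI i₁ | I′⊆fI i₂ | I′⊆fI i₃ | J′⊆fJ j₁ | J′⊆fJ j₂ | J′⊆fJ j₃
  ... | p₁ , p₁∈L , refl | p₂ , p₂∈L , refl | p₃ , p₃∈L , refl
      | r₁ , r₁∈M , fr₁≡fp₁ | r₂ , r₂∈M , fr₂≡fp₂ | r₃ , r₃∈M , fr₃≡fp₃ =
    Sum.map (cong f) (Sum.map (cong f) (cong f))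
      (I⊥J L M p₁ p₂ p₃ p₁∈L p₂∈L p₃∈L (on-M r₁∈M fr₁≡fp₁) (on-M r₂∈M fr₂≡fp₂) (on-M r₃∈M fr₃≡fp₃))
    where
    on-M : ∀ {r p} → J r M → f r ≡ f p → J p M
    on-M r∈M fr≡fp = subst (λ r → J r M) (f-injective fr≡fp) r∈M

module Characteristic2Plane {q : ℕ} (F : FiniteField q)
    (1+1≡0 : Characteristic2 F) where
  open Characteristic2Properties F 1+1≡0 public
  open AffinePlanes F public using (Point; Line; line; _∈AG_; AG; AG^; Orthogoval)

  infixl 6 _⊕_
  _⊕_ : Point → Point → Point
  (x , y) ⊕ (x′ , y′) = (x + x′ , y + y′)

  infixr 7 _·_
  _·_ : Carrier → Point → Point
  l · (x , y) = (l * x , l * y)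

  origin : Point
  origin = (0# , 0#)

  -- In characteristic 2 the determinant x y′ − y x′ is x y′ + y x′.
  det : Point → Point → Carrier
  det (x , y) (x′ , y′) = x * y′ + y * x′

  ⊕≡origin⇒≡ : ∀ {p p′} → p ⊕ p′ ≡ origin → p ≡ p′
  ⊕≡origin⇒≡ eq = cong₂ _,_ (x+y≡0⇒x≡y (cong proj₁ eq)) (x+y≡0⇒x≡y (cong proj₂ eq))

  ⊕-self : ∀ p → p ⊕ p ≡ origin
  ⊕-self (x , y) = cong₂ _,_ (x+x≡0 x) (x+x≡0 y)

  ⊕-cancelʳ : ∀ {p p′} r → p ⊕ r ≡ p′ ⊕ r → p ≡ p′
  ⊕-cancelʳ (x , y) eq = cong₂ _,_ (+-cancelʳ x (cong proj₁ eq)) (+-cancelʳ y (cong proj₂ eq))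

  0·p≡origin : ∀ p → 0# · p ≡ origin
  0·p≡origin (x , y) = cong₂ _,_ (zeroˡ x) (zeroˡ y)

  1·p≡p : ∀ p → 1# · p ≡ p
  1·p≡p (x , y) = cong₂ _,_ (*-identityˡ x) (*-identityˡ y)

  _isDirectionOf_ : Point → Line → Set
  (x , y) isDirectionOf line a b c _ = a * x + b * y ≡ 0#

  ∈AG⇒⊕-isDirection : ∀ L p p′ → p ∈AG L → p′ ∈AG L → (p ⊕ p′) isDirectionOf L
  ∈AG⇒⊕-isDirection (line a b c _) (x , y) (x′ , y′) p∈L p′∈L = begin
    a * (x + x′) + b * (y + y′)         ≡⟨ solve 6 (λ a b x y x′ y′ → a :* (x :+ x′) :+ b :* (y :+ y′)
                                                      := (a :* x :+ b :* y) :+ (a :* x′ :+ b :* y′)) refl a b x y x′ y′ ⟩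
    (a * x + b * y) + (a * x′ + b * y′) ≡⟨ cong₂ _+_ p∈L p′∈L ⟩
    c + c                               ≡⟨ x+x≡0 c ⟩
    0#                                  ∎
    where open ≡-Reasoning

  a*det≡0 : ∀ {a b x y x′ y′} → a * x + b * y ≡ 0# → a * x′ + b * y′ ≡ 0# → a * det (x , y) (x′ , y′) ≡ 0#
  a*det≡0 {a} {b} {x} {y} {x′} {y′} w∥L z∥L = begin
    a * (x * y′ + y * x′)                        ≡⟨ sym (x+[y+y]≡x _ (b * y * y′)) ⟩
    a * (x * y′ + y * x′) + (b * y * y′ + b * y * y′)
      ≡⟨ solve 6 (λ a b x y x′ y′ → a :* (x :* y′ :+ y :* x′) :+ (b :* y :* y′ :+ b :* y :* y′)
                     := (a :* x :+ b :* y) :* y′ :+ y :* (a :* x′ :+ b :* y′)) refl a b x y x′ y′ ⟩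
    (a * x + b * y) * y′ + y * (a * x′ + b * y′) ≡⟨ cong₂ (λ s t → s * y′ + y * t) w∥L z∥L ⟩
    0# * y′ + y * 0#                             ≡⟨ cong₂ _+_ (zeroˡ y′) (zeroʳ y) ⟩
    0# + 0#                                      ≡⟨ +-identityʳ 0# ⟩
    0#                                           ∎
    where open ≡-Reasoning

  directions-det≡0 : ∀ L {w z} → w isDirectionOf L → z isDirectionOf L → det w z ≡ 0#
  directions-det≡0 (line a b c nondeg) {x , y} {x′ , y′} w∥L z∥L
    with x*y≡0⇒x≡0⊎y≡0 a _ (a*det≡0 w∥L z∥L) | x*y≡0⇒x≡0⊎y≡0 b _ b*det≡0
    where
    b*det≡0 : b * det (x , y) (x′ , y′) ≡ 0#
    b*det≡0 = trans (cong (b *_) (+-comm _ _)) (a*det≡0 (trans (+-comm _ _) w∥L) (trans (+-comm _ _) z∥L))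
  ... | inj₂ det≡0 | _          = det≡0
  ... | inj₁ _     | inj₂ det≡0 = det≡0
  ... | inj₁ a≡0   | inj₁ b≡0   = ⊥-elim (nondeg (a≡0 , b≡0))

  ∈AG⇒det≡0 : ∀ L {p₁ p₂ p₃} → p₁ ∈AG L → p₂ ∈AG L → p₃ ∈AG L → det (p₂ ⊕ p₁) (p₃ ⊕ p₁) ≡ 0#
  ∈AG⇒det≡0 L {p₁} {p₂} {p₃} p₁∈L p₂∈L p₃∈L =
    directions-det≡0 L (∈AG⇒⊕-isDirection L p₂ p₁ p₂∈L p₁∈L) (∈AG⇒⊕-isDirection L p₃ p₁ p₃∈L p₁∈L)

  x≢0⇒multiple : ∀ {x y x′ y′} → x ≢ 0# → x * y′ + y * x′ ≡ 0# → ∃ λ l → (x′ , y′) ≡ l · (x , y)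
  x≢0⇒multiple {x} {y} {x′} {y′} x≢0 det≡0 = x′ * x⁻¹ , cong₂ _,_ (sym (begin
      x′ * x⁻¹ * x   ≡⟨ solve 3 (λ x x⁻¹ x′ → x′ :* x⁻¹ :* x := x⁻¹ :* (x :* x′)) refl x x⁻¹ x′ ⟩
      x⁻¹ * (x * x′) ≡⟨ cancel x′ ⟩
      x′             ∎)) (sym (begin
      x′ * x⁻¹ * y   ≡⟨ solve 3 (λ y x⁻¹ x′ → x′ :* x⁻¹ :* y := x⁻¹ :* (y :* x′)) refl y x⁻¹ x′ ⟩
      x⁻¹ * (y * x′) ≡⟨ cong (x⁻¹ *_) (sym (x+y≡0⇒x≡y det≡0)) ⟩
      x⁻¹ * (x * y′) ≡⟨ cancel y′ ⟩
      y′             ∎))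
    where
    open ≡-Reasoning
    x⁻¹ = proj₁ (inverse x x≢0)
    cancel = x*x⁻¹≡1⇒x⁻¹*[x*y]≡y (proj₂ (inverse x x≢0))

  det≡0⇒parallel : ∀ w z → det w z ≡ 0# → w ≡ origin ⊎ ∃ λ l → z ≡ l · w
  det≡0⇒parallel (x , y) (x′ , y′) det≡0 with x ≟ 0# | y ≟ 0#
  ... | no x≢0  | _       = inj₂ (x≢0⇒multiple x≢0 det≡0)
  ... | yes _   | no y≢0  = inj₂ (Product.map₂ (cong Product.swap) (x≢0⇒multiple y≢0 (trans (+-comm _ _) det≡0)))
  ... | yes x≡0 | yes y≡0 = inj₁ (cong₂ _,_ x≡0 y≡0)

  module _ (f : Point → Point) (f-⊕ : ∀ p p′ → f (p ⊕ p′) ≡ f p ⊕ f p′)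
           (f-separates : ∀ w l → det (f w) (f (l · w)) ≡ 0# → w ≡ origin ⊎ l ≡ 0# ⊎ l ≡ 1#) where

    parallel-cases : ∀ w z → det w z ≡ 0# → det (f w) (f z) ≡ 0# → w ≡ origin ⊎ z ≡ origin ⊎ z ≡ w
    parallel-cases w z det≡0 fdet≡0 with det≡0⇒parallel w z det≡0
    ... | inj₁ w≡0 = inj₁ w≡0
    ... | inj₂ (l , refl) with f-separates w l fdet≡0
    ...   | inj₁ w≡0         = inj₁ w≡0
    ...   | inj₂ (inj₁ refl) = inj₂ (inj₁ (0·p≡origin w))
    ...   | inj₂ (inj₂ refl) = inj₂ (inj₂ (1·p≡p w))

    orthogoval-criterion : Orthogoval AG (AG^ f)
    orthogoval-criterion L M _ _ _ P₁∈L P₂∈L P₃∈L (p₁ , p₁∈M , refl) (p₂ , p₂∈M , refl) (p₃ , p₃∈M , refl) =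
      Sum.map (cong f ∘ sym ∘ ⊕≡origin⇒≡) (Sum.map (cong f ∘ sym ∘ ⊕≡origin⇒≡) (cong f ∘ sym ∘ ⊕-cancelʳ p₁))
        (parallel-cases (p₂ ⊕ p₁) (p₃ ⊕ p₁) (∈AG⇒det≡0 M p₁∈M p₂∈M p₃∈M)
          (subst₂ (λ s t → det s t ≡ 0#) (sym (f-⊕ p₂ p₁)) (sym (f-⊕ p₃ p₁)) (∈AG⇒det≡0 L P₁∈L P₂∈L P₃∈L)))

order-2^n⇒characteristic2 : ∀ {n} → 0 < n → (F : FiniteField (2 ^ n)) → Characteristic2 F
order-2^n⇒characteristic2 {suc n} _ F = trans (cong (_+ 1#) (sym -1≡1)) (-‿inverseˡ 1#)
  where
  open FieldProperties F
  open import Algebra.Properties.Ring ring using (-1*x≈-x)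
  open import Algebra.Properties.Group +-group using (⁻¹-involutive)
  open ≡-Reasoning
  -1≡1 : - 1# ≡ 1#
  -1≡1 = begin
    - 1#                          ≡⟨ sym (x^q≡x (- 1#)) ⟩
    pow (- 1#) (2 ^ suc n)        ≡⟨ pow-double (- 1#) (2 ^ n) ⟩
    pow (- 1# * - 1#) (2 ^ n)     ≡⟨ cong (λ y → pow y (2 ^ n)) (trans (-1*x≈-x (- 1#)) (⁻¹-involutive 1#)) ⟩
    pow 1# (2 ^ n)                ≡⟨ pow-1 (2 ^ n) ⟩
    1#                            ∎

module BinaryField {n : ℕ} (0<n : 0 < n) (F : FiniteField (2 ^ n)) where
  open Characteristic2Plane F (order-2^n⇒characteristic2 0<n F) public

  frob-n≡id : ∀ x → frob n x ≡ x
  frob-n≡id x = trans (sym (pow-2^≡frob n x)) (x^q≡x x)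

  frob³ : ∀ j x → frob j (frob j (frob j x)) ≡ frob (3 ℕ.* j) x
  frob³ j x = begin
    frob j (frob j (frob j x)) ≡⟨ cong (frob j) (frob-∘ j j x) ⟩
    frob j (frob (j ℕ.+ j) x)  ≡⟨ frob-∘ j (j ℕ.+ j) x ⟩
    frob (j ℕ.+ j ℕ.+ j) x     ≡⟨ cong (λ e → frob e x) (j+j+j≡3*j j) ⟩
    frob (3 ℕ.* j) x           ∎
    where
    open ≡-Reasoning
    j+j+j≡3*j : ∀ j → j ℕ.+ j ℕ.+ j ≡ 3 ℕ.* j
    j+j+j≡3*j = solve-∀

  module _ (x : Carrier) where

    IsPeriod : ℕ → Set
    IsPeriod m = frob m x ≡ x

    period-* : ∀ {a} → IsPeriod a → ∀ c → IsPeriod (c ℕ.* a)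
    period-* a-period zero    = refl
    period-* {a} a-period (suc c) = begin
      frob (a ℕ.+ c ℕ.* a) x     ≡⟨ sym (frob-∘ (c ℕ.* a) a x) ⟩
      frob (c ℕ.* a) (frob a x)  ≡⟨ cong (frob (c ℕ.* a)) a-period ⟩
      frob (c ℕ.* a) x           ≡⟨ period-* a-period c ⟩
      x                          ∎
      where open ≡-Reasoning

    period-∸ : ∀ {a b} → IsPeriod a → IsPeriod (a ℕ.+ b) → IsPeriod b
    period-∸ {a} {b} a-period a+b-period = begin
      frob b x             ≡⟨ cong (frob b) (sym a-period) ⟩
      frob b (frob a x)    ≡⟨ frob-∘ b a x ⟩
      frob (a ℕ.+ b) x     ≡⟨ a+b-period ⟩
      x                    ∎
      where open ≡-Reasoning

  frob-fixed : ∀ {j} → Coprime j n → ∀ {x} → frob j x ≡ x → x ≡ 0# ⊎ x ≡ 1#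
  frob-fixed {j} j⊥n {x} fixed = x*x≡x⇒x≡0⊎x≡1 (period-1 (coprime-Bézout j⊥n))
    where
    period-1 : Bézout.Identity 1 j n → IsPeriod x 1
    period-1 (Bézout.+- a b 1+bn≡aj) = period-∸ x {b ℕ.* n} (period-* x (frob-n≡id x) b)
      (subst (IsPeriod x) (trans (sym 1+bn≡aj) (ℕ.+-comm 1 (b ℕ.* n))) (period-* x fixed a))
    period-1 (Bézout.-+ a b 1+aj≡bn) = period-∸ x {a ℕ.* j} (period-* x fixed a)
      (subst (IsPeriod x) (trans (sym 1+aj≡bn) (ℕ.+-comm 1 (a ℕ.* j))) (period-* x (frob-n≡id x) b))

  frob-unit : ∀ j {x y} → x * y ≡ 1# → frob j x * frob j y ≡ 1#
  frob-unit j {x} {y} xy≡1 = trans (sym (frob-* j x y)) (trans (cong (frob j) xy≡1) (frob-1 j))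

  frob-root : ∀ j {s t} → s * t ≡ 1# + t → frob j s * frob j t ≡ 1# + frob j t
  frob-root j {s} {t} st≡1+t = begin
    frob j s * frob j t   ≡⟨ sym (frob-* j s t) ⟩
    frob j (s * t)        ≡⟨ cong (frob j) st≡1+t ⟩
    frob j (1# + t)       ≡⟨ frob-+ j 1# t ⟩
    frob j 1# + frob j t  ≡⟨ cong (_+ frob j t) (frob-1 j) ⟩
    1# + frob j t         ∎
    where open ≡-Reasoning

  -- With a = r, b = σ a, c = σ b, d = σ c for σ = frob j, the equations
  -- b a = 1 + a, c b = 1 + b, d c = 1 + c give c (1 + a) = 1 and then d = a.
  root⇒frob[3j]-fixed : ∀ j {r} → frob j r * r ≡ 1# + r → frob (3 ℕ.* j) r ≡ r
  root⇒frob[3j]-fixed j {a} ba≡1+a = trans (sym (frob³ j a)) (begin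
    d                    ≡⟨ sym (*-identityʳ d) ⟩
    d * 1#               ≡⟨ cong (d *_) (sym c[1+a]≡1) ⟩
    d * (c * (1# + a))   ≡⟨ solve 3 (λ a c d → d :* (c :* (con 1 :+ a)) := (d :* c) :* (con 1 :+ a)) refl a c d ⟩
    (d * c) * (1# + a)   ≡⟨ cong (_* (1# + a)) dc≡1+c ⟩
    (1# + c) * (1# + a)  ≡⟨ solve 2 (λ a c → (con 1 :+ c) :* (con 1 :+ a) := (con 1 :+ a) :+ c :* (con 1 :+ a)) refl a c ⟩
    (1# + a) + c * (1# + a) ≡⟨ cong ((1# + a) +_) c[1+a]≡1 ⟩
    (1# + a) + 1#        ≡⟨ solve 1 (λ a → (con 1 :+ a) :+ con 1 := a :+ (con 1 :+ con 1)) refl a ⟩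
    a + (1# + 1#)        ≡⟨ x+[y+y]≡x a 1# ⟩
    a                    ∎)
    where
    open ≡-Reasoning
    b = frob j a
    c = frob j b
    d = frob j c
    cb≡1+b : c * b ≡ 1# + b
    cb≡1+b = frob-root j ba≡1+a
    dc≡1+c : d * c ≡ 1# + c
    dc≡1+c = frob-root j cb≡1+b
    c[1+a]≡1 : c * (1# + a) ≡ 1#
    c[1+a]≡1 = begin
      c * (1# + a)   ≡⟨ cong (c *_) (sym ba≡1+a) ⟩
      c * (b * a)    ≡⟨ solve 3 (λ a b c → c :* (b :* a) := (c :* b) :* a) refl a b c ⟩
      (c * b) * a    ≡⟨ cong (_* a) cb≡1+b ⟩
      (1# + b) * a   ≡⟨ solve 2 (λ a b → (con 1 :+ b) :* a := a :+ b :* a) refl a b ⟩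
      a + b * a      ≡⟨ cong (a +_) ba≡1+a ⟩
      a + (1# + a)   ≡⟨ solve 1 (λ a → a :+ (con 1 :+ a) := con 1 :+ (a :+ a)) refl a ⟩
      1# + (a + a)   ≡⟨ x+[y+y]≡x 1# a ⟩
      1#             ∎

  frob[r]*r≢1+r : ∀ j → Coprime (3 ℕ.* j) n → ∀ r → frob j r * r ≢ 1# + r
  frob[r]*r≢1+r j 3j⊥n r root with frob-fixed 3j⊥n (root⇒frob[3j]-fixed j root)
  ... | inj₁ refl = 0≢1 (begin
    0#                ≡⟨ sym (zeroʳ _) ⟩
    frob j 0# * 0#    ≡⟨ root ⟩
    1# + 0#           ≡⟨ +-identityʳ 1# ⟩
    1#                ∎)
    where open ≡-Reasoning
  ... | inj₂ refl = 0≢1 (begin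
    0#                ≡⟨ sym (x+x≡0 1#) ⟩
    1# + 1#           ≡⟨ sym root ⟩
    frob j 1# * 1#    ≡⟨ *-identityʳ _ ⟩
    frob j 1#         ≡⟨ frob-1 j ⟩
    1#                ∎)
    where open ≡-Reasoning

  frobForm : ℕ → Point → Carrier
  frobForm j (u , v) = frob j u * (u + v) + v * frob j v

  -- For u ≠ 0, dividing by σ(u) u turns the form into 1 + r + σ(r) r with r = v / u.
  frobForm≡0⇒origin : ∀ j → Coprime (3 ℕ.* j) n → ∀ w → frobForm j w ≡ 0# → w ≡ origin
  frobForm≡0⇒origin j 3j⊥n (u , v) Q≡0 with u ≟ 0#
  ... | yes refl = cong (0# ,_) ([ id , frob≡0⇒≡0 j ]′ (x*y≡0⇒x≡0⊎y≡0 v _ v*frob[v]≡0))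
    where
    open ≡-Reasoning
    v*frob[v]≡0 : v * frob j v ≡ 0#
    v*frob[v]≡0 = begin
      v * frob j v                       ≡⟨ sym (+-identityˡ _) ⟩
      0# + v * frob j v                  ≡⟨ cong (_+ v * frob j v) (sym (zeroˡ (0# + v))) ⟩
      0# * (0# + v) + v * frob j v       ≡⟨ cong (λ s → s * (0# + v) + v * frob j v) (sym (frob-0 j)) ⟩
      frob j 0# * (0# + v) + v * frob j v ≡⟨ Q≡0 ⟩
      0#                                 ∎
  ... | no u≢0 = ⊥-elim (frob[r]*r≢1+r j 3j⊥n r (sym (x+y≡0⇒x≡y 1+r+σr*r≡0)))
    where
    open ≡-Reasoning
    u⁻¹ = proj₁ (inverse u u≢0)
    uu⁻¹≡1 : u * u⁻¹ ≡ 1#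
    uu⁻¹≡1 = proj₂ (inverse u u≢0)
    r = v * u⁻¹
    σ = frob j
    1+r+σr*r≡0 : 1# + r + σ r * r ≡ 0#
    1+r+σr*r≡0 = begin
      1# + r + σ r * r                              ≡⟨ cong₂ (λ s t → s + t * r) (sym (*-identityˡ _)) (frob-* j v u⁻¹) ⟩
      1# * (1# + r) + (σ v * σ u⁻¹) * r
        ≡⟨ cong₂ (λ s t → s * (t + r) + (σ v * σ u⁻¹) * r) (sym (frob-unit j uu⁻¹≡1)) (sym uu⁻¹≡1) ⟩
      (σ u * σ u⁻¹) * (u * u⁻¹ + r) + (σ v * σ u⁻¹) * r
        ≡⟨ solve 6 (λ σu σv σu⁻¹ u v u⁻¹ →
                      (σu :* σu⁻¹) :* (u :* u⁻¹ :+ v :* u⁻¹) :+ (σv :* σu⁻¹) :* (v :* u⁻¹)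
                      := (σu :* (u :+ v) :+ v :* σv) :* (σu⁻¹ :* u⁻¹))
                   refl (σ u) (σ v) (σ u⁻¹) u v u⁻¹ ⟩
      frobForm j (u , v) * (σ u⁻¹ * u⁻¹)            ≡⟨ cong (_* (σ u⁻¹ * u⁻¹)) Q≡0 ⟩
      0# * (σ u⁻¹ * u⁻¹)                            ≡⟨ zeroˡ _ ⟩
      0#                                            ∎

  det-factor⇒separates : ∀ j (f : Point → Point) (Q : Point → Carrier) → Coprime j n →
                         (∀ w → Q w ≡ 0# → w ≡ origin) →
                         (∀ l w → det (f w) (f (l · w)) ≡ (l + frob j l) * Q w) →
                         ∀ w l → det (f w) (f (l · w)) ≡ 0# → w ≡ origin ⊎ l ≡ 0# ⊎ l ≡ 1#
  det-factor⇒separates j f Q j⊥n Q≡0⇒origin det≡ w l det≡0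
    with x*y≡0⇒x≡0⊎y≡0 (l + frob j l) (Q w) (trans (sym (det≡ l w)) det≡0)
  ... | inj₁ l+σl≡0 = inj₂ (frob-fixed j⊥n (sym (x+y≡0⇒x≡y l+σl≡0)))
  ... | inj₂ Q≡0    = inj₁ (Q≡0⇒origin w Q≡0)

module Phi {n : ℕ} (0<n : 0 < n) (F : FiniteField (2 ^ n)) (k : ℕ) where
  open BinaryField 0<n F public
  open AffinePlanes F using (φ)

  σ τ : Carrier → Carrier
  σ = frob k
  τ = frob (k ℕ.+ k)

  φ-frob : ∀ x y → φ k (x , y) ≡ (σ x + y , σ y + x + y)
  φ-frob x y = cong₂ _,_ (cong (_+ y) (pow-2^≡frob k x)) (cong (λ s → s + x + y) (pow-2^≡frob k y))

  φ-⊕ : ∀ p p′ → φ k (p ⊕ p′) ≡ φ k p ⊕ φ k p′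
  φ-⊕ (x , y) (x′ , y′) = begin
    φ k (x + x′ , y + y′)
      ≡⟨ φ-frob (x + x′) (y + y′) ⟩
    (σ (x + x′) + (y + y′) , σ (y + y′) + (x + x′) + (y + y′))
      ≡⟨ cong₂ (λ s t → (s + (y + y′) , t + (x + x′) + (y + y′))) (frob-+ k x x′) (frob-+ k y y′) ⟩
    ((σ x + σ x′) + (y + y′) , (σ y + σ y′) + (x + x′) + (y + y′))
      ≡⟨ cong₂ _,_ (solve 4 (λ a b c d → (a :+ b) :+ (c :+ d) := (a :+ c) :+ (b :+ d)) refl (σ x) (σ x′) y y′)
                   (solve 6 (λ a b c d e f → (a :+ b) :+ (c :+ d) :+ (e :+ f) := (a :+ c :+ e) :+ (b :+ d :+ f))
                          refl (σ y) (σ y′) x x′ y y′) ⟩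
    (σ x + y + (σ x′ + y′) , σ y + x + y + (σ y′ + x′ + y′))
      ≡⟨ sym (cong₂ _⊕_ (φ-frob x y) (φ-frob x′ y′)) ⟩
    φ k (x , y) ⊕ φ k (x′ , y′) ∎
    where open ≡-Reasoning

  φφ-⊕ : ∀ p p′ → φ k (φ k (p ⊕ p′)) ≡ φ k (φ k p) ⊕ φ k (φ k p′)
  φφ-⊕ p p′ = trans (cong (φ k) (φ-⊕ p p′)) (φ-⊕ (φ k p) (φ k p′))

  φφ-frob : ∀ x y → φ k (φ k (x , y)) ≡ (τ x + x + y , τ y + x)
  φφ-frob x y = begin
    φ k (φ k (x , y))
      ≡⟨ cong (φ k) (φ-frob x y) ⟩
    φ k (σ x + y , σ y + x + y)
      ≡⟨ φ-frob _ _ ⟩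
    (σ (σ x + y) + (σ y + x + y) , σ (σ y + x + y) + (σ x + y) + (σ y + x + y))
      ≡⟨ cong₂ (λ s t → (s + (σ y + x + y) , t + (σ x + y) + (σ y + x + y)))
               (frob-+ k _ _) (trans (frob-+ k _ _) (cong (_+ σ y) (frob-+ k _ _))) ⟩
    ((σ (σ x) + σ y) + (σ y + x + y) , (σ (σ y) + σ x + σ y) + (σ x + y) + (σ y + x + y))
      ≡⟨ cong₂ _,_
           (x≡y+[t+t]⇒x≡y (σ y) (solve 4 (λ A B x y → (A :+ B) :+ (B :+ x :+ y) := (A :+ x :+ y) :+ (B :+ B))
                                        refl (σ (σ x)) (σ y) x y))
           (x≡y+[t+t]⇒x≡y (σ x + σ y + y) (solve 5 (λ A a b x y → (A :+ a :+ b) :+ (a :+ y) :+ (b :+ x :+ y)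
                                                        := (A :+ x) :+ ((a :+ b :+ y) :+ (a :+ b :+ y)))
                                                   refl (σ (σ y)) (σ x) (σ y) x y)) ⟩
    (σ (σ x) + x + y , σ (σ y) + x)
      ≡⟨ cong₂ (λ s t → (s + x + y , t + x)) (frob-∘ k k x) (frob-∘ k k y) ⟩
    (τ x + x + y , τ y + x) ∎
    where open ≡-Reasoning

  φ-det : ∀ l w → det (φ k w) (φ k (l · w)) ≡ (l + σ l) * frobForm k w
  φ-det l (x , y) = begin
    det (φ k (x , y)) (φ k (l * x , l * y))
      ≡⟨ cong₂ det (φ-frob x y) (φ-frob (l * x) (l * y)) ⟩
    det (σ x + y , σ y + x + y) (σ (l * x) + l * y , σ (l * y) + l * x + l * y)
      ≡⟨ cong₂ (λ s t → det (σ x + y , σ y + x + y) (s + l * y , t + l * x + l * y)) (frob-* k l x) (frob-* k l y) ⟩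
    det (σ x + y , σ y + x + y) (σ l * σ x + l * y , σ l * σ y + l * x + l * y)
      ≡⟨ x≡y+[t+t]⇒x≡y (σ l * σ x * σ y + l * x * y + l * y * y)
           (solve 6 (λ l L s₁ s₂ w₁ w₂ →
                       (s₁ :+ w₂) :* (L :* s₂ :+ l :* w₁ :+ l :* w₂) :+ (s₂ :+ w₁ :+ w₂) :* (L :* s₁ :+ l :* w₂)
                       := (l :+ L) :* (s₁ :* (w₁ :+ w₂) :+ w₂ :* s₂)
                          :+ ((L :* s₁ :* s₂ :+ l :* w₁ :* w₂ :+ l :* w₂ :* w₂)
                              :+ (L :* s₁ :* s₂ :+ l :* w₁ :* w₂ :+ l :* w₂ :* w₂)))
                  refl l (σ l) (σ x) (σ y) x y) ⟩
    (l + σ l) * frobForm k (x , y) ∎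
    where open ≡-Reasoning

  φφ-det : ∀ l w → det (φ k (φ k w)) (φ k (φ k (l · w))) ≡ (l + τ l) * frobForm (k ℕ.+ k) (Product.swap w)
  φφ-det l (x , y) = begin
    det (φ k (φ k (x , y))) (φ k (φ k (l * x , l * y)))
      ≡⟨ cong₂ det (φφ-frob x y) (φφ-frob (l * x) (l * y)) ⟩
    det (τ x + x + y , τ y + x) (τ (l * x) + l * x + l * y , τ (l * y) + l * x)
      ≡⟨ cong₂ (λ s t → det (τ x + x + y , τ y + x) (s + l * x + l * y , t + l * x))
               (frob-* (k ℕ.+ k) l x) (frob-* (k ℕ.+ k) l y) ⟩
    det (τ x + x + y , τ y + x) (τ l * τ x + l * x + l * y , τ l * τ y + l * x)
      ≡⟨ x≡y+[t+t]⇒x≡y (τ l * τ x * τ y + l * x * x + l * x * y)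
           (solve 6 (λ l L t₁ t₂ w₁ w₂ →
                       (t₁ :+ w₁ :+ w₂) :* (L :* t₂ :+ l :* w₁) :+ (t₂ :+ w₁) :* (L :* t₁ :+ l :* w₁ :+ l :* w₂)
                       := (l :+ L) :* (t₂ :* (w₂ :+ w₁) :+ w₁ :* t₁)
                          :+ ((L :* t₁ :* t₂ :+ l :* w₁ :* w₁ :+ l :* w₁ :* w₂)
                              :+ (L :* t₁ :* t₂ :+ l :* w₁ :* w₁ :+ l :* w₁ :* w₂)))
                  refl l (τ l) (τ x) (τ y) x y) ⟩
    (l + τ l) * frobForm (k ℕ.+ k) (y , x) ∎
    where open ≡-Reasoning

  frobForm-φ : ∀ x y → frobForm k (x , y) ≡ proj₁ (φ k (x , y)) * (x + y) + y * proj₂ (φ k (x , y))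
  frobForm-φ x y = sym (begin
    proj₁ (φ k (x , y)) * (x + y) + y * proj₂ (φ k (x , y))
      ≡⟨ cong₂ (λ s t → s * (x + y) + y * t) (cong proj₁ (φ-frob x y)) (cong proj₂ (φ-frob x y)) ⟩
    (σ x + y) * (x + y) + y * (σ y + x + y)
      ≡⟨ x≡y+[t+t]⇒x≡y (y * x + y * y)
           (solve 4 (λ s₁ s₂ x y → (s₁ :+ y) :* (x :+ y) :+ y :* (s₂ :+ x :+ y)
                                  := s₁ :* (x :+ y) :+ y :* s₂ :+ ((y :* x :+ y :* y) :+ (y :* x :+ y :* y)))
                  refl (σ x) (σ y) x y) ⟩
    frobForm k (x , y) ∎)
    where open ≡-Reasoning

module Orthogovality {n : ℕ} (0<n : 0 < n) (F : FiniteField (2 ^ n)) {k : ℕ} (6k⊥n : Coprime (6 ℕ.* k) n) where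
  open Phi 0<n F k
  open AffinePlanes F using (φ)

  private
    divisor-coprime : ∀ c {d} → 6 ℕ.* k ≡ c ℕ.* d → Coprime d n
    divisor-coprime c 6k≡cd (i∣d , i∣n) = 6k⊥n (∣-trans i∣d (divides c 6k≡cd) , i∣n)

    6k≡3[k+k] : ∀ k → 6 ℕ.* k ≡ 3 ℕ.* (k ℕ.+ k)
    6k≡3[k+k] = solve-∀
    6k≡2[3k] : ∀ k → 6 ℕ.* k ≡ 2 ℕ.* (3 ℕ.* k)
    6k≡2[3k] = solve-∀
    6k≡1[3[k+k]] : ∀ k → 6 ℕ.* k ≡ 1 ℕ.* (3 ℕ.* (k ℕ.+ k))
    6k≡1[3[k+k]] = solve-∀

    k⊥n : Coprime k n
    k⊥n = divisor-coprime 6 refl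
    k+k⊥n : Coprime (k ℕ.+ k) n
    k+k⊥n = divisor-coprime 3 (6k≡3[k+k] k)
    3k⊥n : Coprime (3 ℕ.* k) n
    3k⊥n = divisor-coprime 2 (6k≡2[3k] k)
    3[k+k]⊥n : Coprime (3 ℕ.* (k ℕ.+ k)) n
    3[k+k]⊥n = divisor-coprime 1 (6k≡1[3[k+k]] k)

  φ≡origin⇒≡origin : ∀ w → φ k w ≡ origin → w ≡ origin
  φ≡origin⇒≡origin (x , y) φw≡0 = frobForm≡0⇒origin k 3k⊥n (x , y) (begin
    frobForm k (x , y)                                       ≡⟨ frobForm-φ x y ⟩
    proj₁ (φ k (x , y)) * (x + y) + y * proj₂ (φ k (x , y))
      ≡⟨ cong₂ (λ s t → s * (x + y) + y * t) (cong proj₁ φw≡0) (cong proj₂ φw≡0) ⟩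
    0# * (x + y) + y * 0#                                    ≡⟨ cong₂ _+_ (zeroˡ (x + y)) (zeroʳ y) ⟩
    0# + 0#                                                  ≡⟨ +-identityʳ 0# ⟩
    0#                                                       ∎)
    where open ≡-Reasoning

  φ-injective : Injective _≡_ _≡_ (φ k)
  φ-injective {p} {p′} φp≡φp′ = ⊕≡origin⇒≡ (φ≡origin⇒≡origin (p ⊕ p′) (begin
    φ k (p ⊕ p′)       ≡⟨ φ-⊕ p p′ ⟩
    φ k p ⊕ φ k p′     ≡⟨ cong (_⊕ φ k p′) φp≡φp′ ⟩
    φ k p′ ⊕ φ k p′    ≡⟨ ⊕-self (φ k p′) ⟩
    origin             ∎))
    where open ≡-Reasoning

  φ-surjective : Surjective _≡_ _≡_ (φ k)
  φ-surjective = injective⇒surjective (Point-enumeration F) (φ k) φ-injective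

  AG⊥AG^φ : Orthogoval AG (AG^ (φ k))
  AG⊥AG^φ = orthogoval-criterion (φ k) φ-⊕
    (det-factor⇒separates k (φ k) (frobForm k) k⊥n (frobForm≡0⇒origin k 3k⊥n) φ-det)

  AG⊥AG^φφ : Orthogoval AG (AG^ (φ k ∘ φ k))
  AG⊥AG^φφ = orthogoval-criterion (φ k ∘ φ k) φφ-⊕
    (det-factor⇒separates (k ℕ.+ k) (φ k ∘ φ k) (frobForm (k ℕ.+ k) ∘ Product.swap) k+k⊥n
      (λ w Q≡0 → cong Product.swap (frobForm≡0⇒origin (k ℕ.+ k) 3[k+k]⊥n (Product.swap w) Q≡0)) φφ-det)

  AG^φ⊥AG^φφ : Orthogoval (AG^ (φ k)) (AG^ (φ k ∘ φ k))
  AG^φ⊥AG^φφ = orthogoval-image F (φ k) φ-injective (λ P∈L → P∈L)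
    (λ { (p , p∈M , φφp≡P) → φ k p , (p , p∈M , refl) , φφp≡P }) AG⊥AG^φ

-- Imported only now: in the modules above _*_ is the field multiplication.
open import Data.Nat using (_*_)

theorem3p15 : (n k : ℕ) → 0 < n → 0 < k → gcd (6 * k) n ≡ 1 →
    (F : FiniteField (2 ^ n)) →
    let open AffinePlanes F in
      Bijective _≡_ _≡_ (φ k)
      × Orthogoval AG (AG^ (φ k))
      × Orthogoval AG (AG^ (φ k ∘ φ k))
      × Orthogoval (AG^ (φ k)) (AG^ (φ k ∘ φ k))
theorem3p15 n k 0<n _ gcd[6k,n]≡1 F =
  (φ-injective , φ-surjective) , AG⊥AG^φ , AG⊥AG^φφ , AG^φ⊥AG^φφ
  where open Orthogovality 0<n F {k} (gcd≡1⇒coprime gcd[6k,n]≡1)
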